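{- Let $r,s,t$ be rational numbers with $r\neq\pm1$, $s\neq\pm1$, $s\neq\pm r$, and $$\frac{s^2r^2-1}{s^2-r^2}=t^2.$$ Set $a=s^2-r^2$, $b=\frac{r^4-1}{a}$, $c=\frac{s^4-1}{a}$. Then $b=t^2-r^2$, $c=s^2+t^2$, and $(a,b,c)$ is a rational quartic Diophantine triple.
   Context: A (rational) quartic Diophantine triple is a triple $(a,b,c)$ of distinct nonzero rational numbers such that $ab+1=r^4$, $ac+1=s^4$, $bc+1=t^4$ for some rational numbers $r,s,t$. -}

module Defs where

open import Data.Rational using (ℚ; 0ℚ; 1ℚ; _+_; _*_; _-_; -_; _÷_; ≢-nonZero)
open import Data.Rational.Properties using (_≟_)
open import Data.Product using (_×_; ∃)
open import Relation.Binary.PropositionalEquality using (_≡_; _≢_)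
open import Relation.Nullary using (yes; no)

sq : ℚ → ℚ
sq x = x * x

pow4 : ℚ → ℚ
pow4 x = sq (sq x)

-- Total division: p /ℚ q = p ÷ q when q ≢ 0 (the convention p/0 = 0 is
-- only used outside the hypotheses of the theorem, where denominators are nonzero).
infixl 7 _/ℚ_
_/ℚ_ : ℚ → ℚ → ℚ
p /ℚ q with q ≟ 0ℚ
... | yes _ = 0ℚ
... | no q≢0 = _÷_ p q {{≢-nonZero q≢0}}

QuarticDiophantineTriple : ℚ → ℚ → ℚ → Set
QuarticDiophantineTriple a b c =
  (a ≢ b × a ≢ c × b ≢ c) ×
  (a ≢ 0ℚ × b ≢ 0ℚ × c ≢ 0ℚ) ×
  (∃ λ r → a * b + 1ℚ ≡ pow4 r) ×
  (∃ λ s → a * c + 1ℚ ≡ pow4 s) ×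
  (∃ λ t → b * c + 1ℚ ≡ pow4 t)

{-# OPTIONS --safe #-}
-- Apart from distinctness, everything is field arithmetic: multiplied out by a = s² − r², the
-- hypothesis is the polynomial identity s²r² − 1 = t²a, from which b = t² − r², c = s² + t²,
-- ab + 1 = r⁴, ac + 1 = s⁴ and bc + 1 = t⁴ follow; a, b, c ≠ 0 because s ≠ ±r, r ≠ ±1, s ≠ ±1.
-- Distinctness is arithmetic: two equal members p = q of the triple would make p² + 1 a fourth
-- power with p ≠ 0, and clearing denominators gives x⁴ = y⁴ + z² in positive integers. Fermat's
-- descent rules this out: parametrising the primitive Pythagorean triple (y², z, x²) or
-- (z, y², x²), according to the parity of y, turns a primitive solution into one with smaller x.
module Submission where

module FermatDescent where

  open import Data.Nat.Base
  open import Data.Nat.Properties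
  open import Data.Nat.Divisibility
  open import Data.Nat.DivMod
  open import Data.Nat.GCD using (gcd; gcd[m,n]∣m; gcd[m,n]∣n; gcd[m,n]≢0)
  open import Data.Nat.Coprimality using (Coprime; coprime-divisor; coprime-/gcd)
    renaming (sym to coprime-sym)
  open import Data.Nat.Induction using (<-rec)
  open import Data.Nat.Tactic.RingSolver using (solve)
  open import Data.List.Base using (_∷_; [])
  open import Data.Product using (_×_; _,_; ∃-syntax)
  open import Data.Sum using (_⊎_; inj₁; inj₂; [_,_]′)
  open import Data.Nat.Primality using (euclidsLemma; prime?)
  open import Relation.Nullary.Decidable using (from-yes)
  open import Relation.Nullary using (¬_; contradiction)
  open import Relation.Binary.PropositionalEquality
  open ≡-Reasoning

  private variable a b c d i j u v w : ℕ

  coprime-∣ : Coprime a b → c ∣ a → d ∣ b → Coprime c d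
  coprime-∣ a⊥b c∣a d∣b (i∣c , i∣d) = a⊥b (∣-trans i∣c c∣a , ∣-trans i∣d d∣b)

  coprime-*ʳ : Coprime a b → Coprime a c → Coprime a (b * c)
  coprime-*ʳ a⊥b a⊥c (i∣a , i∣bc) = a⊥c (i∣a , coprime-divisor (coprime-∣ a⊥b i∣a ∣-refl) i∣bc)

  coprime-square : Coprime a b → Coprime (a * a) (b * b)
  coprime-square a⊥b = coprime-sym (coprime-*ʳ b⊥aa b⊥aa)
    where b⊥aa = coprime-sym (coprime-*ʳ a⊥b a⊥b)

  0<m*n⇒0<n : ∀ m {n} → 0 < m * n → 0 < n
  0<m*n⇒0<n m 0<mn = n≢0⇒n>0 λ { refl → <-irrefl (sym (*-zeroʳ m)) 0<mn }

  0<m*n⇒0<m : ∀ m {n} → 0 < m * n → 0 < m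
  0<m*n⇒0<m m {n} 0<mn = 0<m*n⇒0<n n (subst (0 <_) (*-comm m n) 0<mn)

  gcd-cofactors : ∀ m n → 0 < n →
    ∃[ g ] ∃[ m′ ] ∃[ n′ ] 0 < g × m ≡ m′ * g × n ≡ n′ * g × Coprime m′ n′
  gcd-cofactors m n 0<n =
    gcd m n , m / gcd m n , n / gcd m n , n≢0⇒n>0 g≢0 ,
    sym (m/n*n≡m (gcd[m,n]∣m m n)) , sym (m/n*n≡m (gcd[m,n]∣n m n)) , coprime-/gcd m n
    where
    g≢0 : gcd m n ≢ 0
    g≢0 = gcd[m,n]≢0 m n (inj₂ λ n≡0 → <-irrefl (sym n≡0) 0<n)
    instance _ = ≢-nonZero g≢0

  square-cancel-≤ : ∀ {m n} → m * m ≤ n * n → m ≤ n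
  square-cancel-≤ m²≤n² = ≮⇒≥ λ n<m → <⇒≱ (*-mono-< n<m n<m) m²≤n²

  square-cancel-< : ∀ {m n} → m * m < n * n → m < n
  square-cancel-< m²<n² = ≰⇒> λ n≤m → <⇒≱ m²<n² (*-mono-≤ n≤m n≤m)

  square-injective : ∀ {m n} → m * m ≡ n * n → m ≡ n
  square-injective eq = ≤-antisym (square-cancel-≤ (≤-reflexive eq)) (square-cancel-≤ (≤-reflexive (sym eq)))

  square-∣-square⇒∣ : ∀ {m n} → m * m ∣ n * n → m ∣ n
  square-∣-square⇒∣ {zero} {n} 0∣n² = ∣-reflexive (sym (square-injective {n} {0} (0∣⇒≡0 0∣n²)))
  square-∣-square⇒∣ {m@(suc _)} {n} m²∣n² with gcd-cofactors n m z<s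
  ... | g , n′ , m′ , 0<g , n≡n′g , m≡m′g , n′⊥m′ = divides n′ (trans n≡n′g (cong (n′ *_) g≡m))
    where
    instance _ = >-nonZero (*-mono-< 0<g 0<g)
    m′²∣n′² : m′ * m′ ∣ n′ * n′
    m′²∣n′² = *-cancelʳ-∣ (g * g) (subst₂ _∣_
      (trans (cong (λ k → k * k) m≡m′g) (solve (m′ ∷ g ∷ [])))
      (trans (cong (λ k → k * k) n≡n′g) (solve (n′ ∷ g ∷ []))) m²∣n²)
    m′≡1 : m′ ≡ 1
    m′≡1 = coprime-*ʳ m′⊥n′ m′⊥n′ (∣-refl , ∣-trans (m∣m*n m′) m′²∣n′²)
      where m′⊥n′ = coprime-sym n′⊥m′
    g≡m : g ≡ m
    g≡m = sym (trans m≡m′g (trans (cong (_* g) m′≡1) (*-identityˡ g)))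

  coprime-*-square⇒square : Coprime u v → u * v ≡ w * w → ∃[ k ] u ≡ k * k
  coprime-*-square⇒square {zero} _ _ = 0 , refl
  coprime-*-square⇒square {u@(suc _)} {v} {w} u⊥v uv≡w² with gcd-cofactors w u z<s
  ... | g , w′ , u′ , 0<g , w≡w′g , u≡u′g , w′⊥u′ = u′ , u≡u′u′
    where
    instance _ = >-nonZero 0<g
    u′v≡w′²g : u′ * v ≡ w′ * w′ * g
    u′v≡w′²g = *-cancelʳ-≡ _ _ g (begin
      u′ * v * g          ≡⟨ solve (u′ ∷ v ∷ g ∷ []) ⟩
      u′ * g * v          ≡⟨ cong (_* v) u≡u′g ⟨
      u * v               ≡⟨ uv≡w² ⟩
      w * w               ≡⟨ cong (λ k → k * k) w≡w′g ⟩
      w′ * g * (w′ * g)   ≡⟨ solve (w′ ∷ g ∷ []) ⟩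
      w′ * w′ * g * g     ∎)
    u′⊥w′ = coprime-sym w′⊥u′
    u′∣g : u′ ∣ g
    u′∣g = coprime-divisor (coprime-*ʳ u′⊥w′ u′⊥w′) (divides v (trans (sym u′v≡w′²g) (*-comm u′ v)))
    open _∣_ u′∣g renaming (quotient to k; equality to g≡ku′)
    instance _ = >-nonZero (0<m*n⇒0<n k (subst (0 <_) g≡ku′ 0<g))
    v≡w′²k : v ≡ w′ * w′ * k
    v≡w′²k = *-cancelˡ-≡ _ _ u′ (begin
      u′ * v              ≡⟨ u′v≡w′²g ⟩
      w′ * w′ * g         ≡⟨ cong (w′ * w′ *_) g≡ku′ ⟩
      w′ * w′ * (k * u′)  ≡⟨ *-assoc (w′ * w′) k u′ ⟨
      w′ * w′ * k * u′    ≡⟨ *-comm (w′ * w′ * k) u′ ⟩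
      u′ * (w′ * w′ * k)  ∎)
    k≡1 : k ≡ 1
    k≡1 = u⊥v (∣-trans (divides u′ (trans g≡ku′ (*-comm k u′))) (divides u′ u≡u′g) ,
               divides (w′ * w′) v≡w′²k)
    u≡u′u′ : u ≡ u′ * u′
    u≡u′u′ = trans u≡u′g (cong (u′ *_) (trans g≡ku′ (trans (cong (_* u′) k≡1) (*-identityˡ u′))))

  coprime-*-square⇒squares : Coprime u v → u * v ≡ w * w → ∃[ k ] ∃[ l ] u ≡ k * k × v ≡ l * l
  coprime-*-square⇒squares {u} {v} {w} u⊥v uv≡w²
    with coprime-*-square⇒square {w = w} u⊥v uv≡w²
       | coprime-*-square⇒square {w = w} (coprime-sym u⊥v) (trans (*-comm v u) uv≡w²)
  ... | k , u≡k² | l , v≡l² = k , l , u≡k² , v≡l²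

  [n*n]%4≡n%2 : ∀ n → (n * n) % 4 ≡ n % 2
  [n*n]%4≡n%2 n = begin
    (n * n) % 4               ≡⟨ %-distribˡ-* n n 4 ⟩
    (n % 4) * (n % 4) % 4     ≡⟨ residues (n % 4) (m%n<n n 4) ⟩
    n % 4 % 2                 ≡⟨ m∣n⇒o%n%m≡o%m 2 4 n (divides 2 refl) ⟩
    n % 2                     ∎
    where
    residues : ∀ r → r < 4 → r * r % 4 ≡ r % 2
    residues 0 _ = refl
    residues 1 _ = refl
    residues 2 _ = refl
    residues 3 _ = refl
    residues (suc (suc (suc (suc _)))) (s≤s (s≤s (s≤s (s≤s ()))))

  [n*n]%2≡n%2 : ∀ n → (n * n) % 2 ≡ n % 2
  [n*n]%2≡n%2 n = begin
    (n * n) % 2      ≡⟨ m∣n⇒o%n%m≡o%m 2 4 (n * n) (divides 2 refl) ⟨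
    (n * n) % 4 % 2  ≡⟨ cong (_% 2) ([n*n]%4≡n%2 n) ⟩
    n % 2 % 2        ≡⟨ m%n%n≡m%n n 2 ⟩
    n % 2            ∎

  even⊎odd : ∀ n → 2 ∣ n ⊎ n % 2 ≡ 1
  even⊎odd n with n % 2 in eq | m%n<n n 2
  ... | 0 | _ = inj₁ (m%n≡0⇒n∣m n 2 eq)
  ... | 1 | _ = inj₂ refl
  ... | suc (suc _) | s≤s (s≤s ())

  %-+-cong : ∀ m n k .{{_ : NonZero k}} → m % k ≡ i → n % k ≡ j → (m + n) % k ≡ (i + j) % k
  %-+-cong m n k m≡i n≡j = trans (%-distribˡ-+ m n k) (cong₂ (λ i j → (i + j) % k) m≡i n≡j)

  odd²+odd²≢square : ∀ {x y z} → y % 2 ≡ 1 → z % 2 ≡ 1 → x * x ≢ y * y + z * z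
  odd²+odd²≢square {x} {y} {z} y-odd z-odd x²≡y²+z² = <-irrefl x%2≡2 (m%n<n x 2)
    where
    x%2≡2 : x % 2 ≡ 2
    x%2≡2 = begin
      x % 2                  ≡⟨ [n*n]%4≡n%2 x ⟨
      (x * x) % 4            ≡⟨ cong (_% 4) x²≡y²+z² ⟩
      (y * y + z * z) % 4    ≡⟨ %-+-cong (y * y) (z * z) 4 (trans ([n*n]%4≡n%2 y) y-odd) (trans ([n*n]%4≡n%2 z) z-odd) ⟩
      2                      ∎

  -- Euclid's parametrisation (a, b, c) = (m² − n², 2mn, m² + n²), with the subtraction moved across.
  record PythagoreanParameters (a b c : ℕ) : Set where
    field
      m n      : ℕ
      m⊥n      : Coprime m n
      a+n²≡m²  : a + n * n ≡ m * m
      b≡2mn    : b ≡ 2 * (m * n)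
      c≡m²+n²  : c ≡ m * m + n * n

  odd-leg : Coprime a b → 2 ∣ b → a % 2 ≡ 1
  odd-leg {a} a⊥b 2∣b with even⊎odd a
  ... | inj₁ 2∣a  = contradiction (a⊥b (2∣a , 2∣b)) λ ()
  ... | inj₂ a-odd = a-odd

  leg≤hypotenuse : a * a + b * b ≡ c * c → a ≤ c
  leg≤hypotenuse {a} {b} eq = square-cancel-≤ (subst (a * a ≤_) eq (m≤m+n (a * a) (b * b)))

  hypotenuse≡leg+even : a * a + b * b ≡ c * c → Coprime a b → 2 ∣ b → ∃[ p ] c ≡ a + 2 * p
  hypotenuse≡leg+even {a} {b} {c} eq a⊥b 2∣b with even⊎odd (c ∸ a)
  ... | inj₁ (divides p c∸a≡p*2) = p , (begin
    c            ≡⟨ m+[n∸m]≡n (leg≤hypotenuse {a} {b} {c} eq) ⟨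
    a + (c ∸ a)  ≡⟨ cong (a +_) (trans c∸a≡p*2 (*-comm p 2)) ⟩
    a + 2 * p    ∎)
  ... | inj₂ c∸a-odd = contradiction (trans (sym c-odd) c-even) λ ()
    where
    a-odd = odd-leg a⊥b 2∣b
    c-odd : c % 2 ≡ 1
    c-odd = begin
      c % 2                ≡⟨ [n*n]%2≡n%2 c ⟨
      (c * c) % 2          ≡⟨ cong (_% 2) eq ⟨
      (a * a + b * b) % 2  ≡⟨ %-+-cong (a * a) (b * b) 2 (trans ([n*n]%2≡n%2 a) a-odd)
                                                        (trans ([n*n]%2≡n%2 b) (n∣m⇒m%n≡0 b 2 2∣b)) ⟩
      1                    ∎
    c-even : c % 2 ≡ 0
    c-even = trans (cong (_% 2) (sym (m+[n∸m]≡n (leg≤hypotenuse {a} {b} {c} eq))))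
                   (%-+-cong a (c ∸ a) 2 a-odd c∸a-odd)

  half-leg² : ∀ {β p} → a * a + b * b ≡ c * c → b ≡ β * 2 → c ≡ a + 2 * p → β * β ≡ p * (a + p)
  half-leg² {a} {b} {c} {β} {p} eq b≡β*2 c≡a+2p = *-cancelˡ-≡ _ _ 4 (+-cancelˡ-≡ (a * a) _ _ (begin
    a * a + 4 * (β * β)        ≡⟨ solve (a ∷ β ∷ []) ⟩
    a * a + β * 2 * (β * 2)    ≡⟨ cong (λ b → a * a + b * b) b≡β*2 ⟨
    a * a + b * b              ≡⟨ eq ⟩
    c * c                      ≡⟨ cong (λ c → c * c) c≡a+2p ⟩
    (a + 2 * p) * (a + 2 * p)  ≡⟨ solve (a ∷ p ∷ []) ⟩
    a * a + 4 * (p * (a + p))  ∎))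

  coprime-p-[a+p] : ∀ {β p} → Coprime a β → β * β ≡ p * (a + p) → Coprime p (a + p)
  coprime-p-[a+p] {a} {β} {p} a⊥β β²≡p[a+p] {i} (i∣p , i∣a+p) = coprime-*ʳ a⊥β a⊥β
    (∣m+n∣m⇒∣n (subst (i ∣_) (+-comm a p) i∣a+p) i∣p ,
     subst (i ∣_) (sym β²≡p[a+p]) (∣m⇒∣m*n (a + p) i∣p))

  primitive-triple-parameters : a * a + b * b ≡ c * c → Coprime a b → 2 ∣ b → PythagoreanParameters a b c
  primitive-triple-parameters {a} {b} {c} eq a⊥b 2∣b@(divides β b≡β*2)
    with p , c≡a+2p ← hypotenuse≡leg+even {a} {b} {c} eq a⊥b 2∣b
    with β²≡p[a+p] ← half-leg² {a} {b} {c} {β} {p} eq b≡β*2 c≡a+2p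
    with p⊥a+p ← coprime-p-[a+p] {β = β} (coprime-∣ a⊥b ∣-refl (divides 2 (trans b≡β*2 (*-comm β 2)))) β²≡p[a+p]
    with n , m , p≡n² , a+p≡m² ← coprime-*-square⇒squares {w = β} p⊥a+p (sym β²≡p[a+p])
    = record
    { m = m ; n = n
    ; m⊥n = coprime-∣ (coprime-sym p⊥a+p) (divides m a+p≡m²) (divides n p≡n²)
    ; a+n²≡m² = trans (cong (a +_) (sym p≡n²)) a+p≡m²
    ; b≡2mn = trans b≡β*2 (trans (*-comm β 2) (cong (2 *_) β≡mn))
    ; c≡m²+n² = begin
        c              ≡⟨ c≡a+2p ⟩
        a + 2 * p      ≡⟨ solve (a ∷ p ∷ []) ⟩
        (a + p) + p    ≡⟨ cong₂ _+_ a+p≡m² p≡n² ⟩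
        m * m + n * n  ∎
    }
    where
    β≡mn : β ≡ m * n
    β≡mn = square-injective {β} {m * n} (trans β²≡p[a+p] (trans (cong₂ _*_ p≡n² a+p≡m²) (solve (n ∷ m ∷ []))))

  record PrimitiveSolution (x : ℕ) : Set where
    field
      y z       : ℕ
      0<y       : 0 < y
      0<z       : 0 < z
      x⊥y       : Coprime x y
      x⁴≡y⁴+z²  : x * x * (x * x) ≡ y * y * (y * y) + z * z

  n≤n*n : ∀ n → n ≤ n * n
  n≤n*n zero = z≤n
  n≤n*n n@(suc _) = m≤m*n n n

  coprime-*-twice-square : Coprime a b → 2 ∣ b → a * b ≡ 2 * (w * w) →
                           ∃[ v ] ∃[ u ] a ≡ v * v × b ≡ 2 * (u * u)
  coprime-*-twice-square {a} {b} {w} a⊥b (divides k b≡k*2) ab≡2w² =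
    let v , u , a≡v² , k≡u² = coprime-*-square⇒squares {w = w} a⊥k ak≡w²
    in v , u , a≡v² , trans b≡k*2 (trans (*-comm k 2) (cong (2 *_) k≡u²))
    where
    a⊥k = coprime-∣ a⊥b ∣-refl (divides 2 (trans b≡k*2 (*-comm k 2)))
    ak≡w² : a * k ≡ w * w
    ak≡w² = *-cancelˡ-≡ _ _ 2 (begin
      2 * (a * k)  ≡⟨ solve (a ∷ k ∷ []) ⟩
      a * (k * 2)  ≡⟨ cong (a *_) b≡k*2 ⟨
      a * b        ≡⟨ ab≡2w² ⟩
      2 * (w * w)  ∎)

  -- m⁴ − n⁴ = (m² − n²)(m² + n²) = y²x², and m < x.
  descent-y-odd : ∀ {x y z} → 0 < y → 0 < z → PythagoreanParameters (y * y) z (x * x) →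
                  ∃[ x′ ] x′ < x × PrimitiveSolution x′
  descent-y-odd {x} {y} {z} 0<y 0<z record
    { m = m ; n = n ; m⊥n = m⊥n ; a+n²≡m² = y²+n²≡m² ; b≡2mn = z≡2mn ; c≡m²+n² = x²≡m²+n² }
    = m , m<x , record
    { y = n ; z = x * y ; 0<y = 0<n ; 0<z = *-mono-< (≤-<-trans z≤n m<x) 0<y
    ; x⊥y = m⊥n ; x⁴≡y⁴+z² = m⁴≡n⁴+[xy]² }
    where
    0<n : 0 < n
    0<n = 0<m*n⇒0<n m (0<m*n⇒0<n 2 (subst (0 <_) z≡2mn 0<z))
    m<x : m < x
    m<x = square-cancel-< (subst (m * m <_) (sym x²≡m²+n²) (m<m+n (m * m) (*-mono-< 0<n 0<n)))
    m⁴≡n⁴+[xy]² : m * m * (m * m) ≡ n * n * (n * n) + x * y * (x * y)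
    m⁴≡n⁴+[xy]² = begin
      m * m * (m * m)                                    ≡⟨ cong (λ k → k * k) y²+n²≡m² ⟨
      (y * y + n * n) * (y * y + n * n)                  ≡⟨ solve (y ∷ n ∷ []) ⟩
      n * n * (n * n) + (y * y + n * n + n * n) * (y * y) ≡⟨ cong (λ k → n * n * (n * n) + (k + n * n) * (y * y)) y²+n²≡m² ⟩
      n * n * (n * n) + (m * m + n * n) * (y * y)        ≡⟨ cong (λ k → n * n * (n * n) + k * (y * y)) x²≡m²+n² ⟨
      n * n * (n * n) + x * x * (y * y)                  ≡⟨ solve (n ∷ x ∷ y ∷ []) ⟩
      n * n * (n * n) + x * y * (x * y)                  ∎

  -- M and N are squares P², Q² since MN = u², so P⁴ − Q⁴ = M² − N² = a = v², and P ≤ M < x.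
  descent-square-legs : ∀ {x a b v u} → 0 < a * b → a ≡ v * v → b ≡ 2 * (u * u) → PythagoreanParameters a b x →
                        ∃[ x′ ] x′ < x × PrimitiveSolution x′
  descent-square-legs {x} {a} {b} {v} {u} 0<ab a≡v² b≡2u² record
    { m = M ; n = N ; m⊥n = M⊥N ; a+n²≡m² = a+N²≡M² ; b≡2mn = b≡2MN ; c≡m²+n² = x≡M²+N² }
    with P , Q , M≡P² , N≡Q² ← coprime-*-square⇒squares {w = u} M⊥N (*-cancelˡ-≡ (M * N) (u * u) 2 (trans (sym b≡2MN) b≡2u²))
    = P , P<x , record
    { y = Q ; z = v ; 0<y = 0<Q ; 0<z = 0<v
    ; x⊥y = coprime-∣ M⊥N (divides P M≡P²) (divides Q N≡Q²)
    ; x⁴≡y⁴+z² = begin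
        P * P * (P * P)      ≡⟨ cong (λ k → k * k) M≡P² ⟨
        M * M                ≡⟨ a+N²≡M² ⟨
        a + N * N            ≡⟨ cong₂ _+_ a≡v² (cong (λ k → k * k) N≡Q²) ⟩
        v * v + Q * Q * (Q * Q) ≡⟨ +-comm (v * v) _ ⟩
        Q * Q * (Q * Q) + v * v ∎
    }
    where
    0<v : 0 < v
    0<v = 0<m*n⇒0<m v (subst (0 <_) a≡v² (0<m*n⇒0<m a 0<ab))
    0<N : 0 < N
    0<N = 0<m*n⇒0<n M (0<m*n⇒0<n 2 (subst (0 <_) b≡2MN (0<m*n⇒0<n a 0<ab)))
    0<Q : 0 < Q
    0<Q = 0<m*n⇒0<m Q (subst (0 <_) N≡Q² 0<N)
    M<x : M < x
    M<x = ≤-<-trans (n≤n*n M) (subst (M * M <_) (sym x≡M²+N²) (m<m+n (M * M) (*-mono-< 0<N 0<N)))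
    P<x : P < x
    P<x = ≤-<-trans (n≤n*n P) (subst (_< x) M≡P² M<x)

  descent-square-area : ∀ {x a b} → Coprime a b → 2 ∣ b → 0 < w → a * b ≡ 2 * (w * w) → a * a + b * b ≡ x * x →
                        ∃[ x′ ] x′ < x × PrimitiveSolution x′
  descent-square-area {w} a⊥b 2∣b 0<w ab≡2w² a²+b²≡x² =
    let v , u , a≡v² , b≡2u² = coprime-*-twice-square {w = w} a⊥b 2∣b ab≡2w²
    in descent-square-legs {v = v} {u = u} 0<ab a≡v² b≡2u² (primitive-triple-parameters a²+b²≡x² a⊥b 2∣b)
    where 0<ab = subst (0 <_) (sym ab≡2w²) (*-mono-< {0} {2} z<s (*-mono-< 0<w 0<w))

  coprime-leg : ∀ {x y z} → Coprime x y → x * x * (x * x) ≡ y * y * (y * y) + z * z → Coprime (y * y) z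
  coprime-leg {x} {y} {z} x⊥y x⁴≡y⁴+z² {i} (i∣y² , i∣z) = coprime-*ʳ y²⊥x² y²⊥x² (i∣y² , i∣x⁴)
    where
    y²⊥x² = coprime-sym (coprime-square x⊥y)
    i∣x⁴ : i ∣ x * x * (x * x)
    i∣x⁴ = subst (i ∣_) (sym x⁴≡y⁴+z²) (∣m∣n⇒∣m+n (∣m⇒∣m*n (y * y) i∣y²) (∣m⇒∣m*n z i∣z))

  -- (m, n, x) is again a primitive triple, and its area mn/2 = w² is a square.
  descent-y-even : ∀ {x y z} → 0 < w → y ≡ w * 2 → PythagoreanParameters z (y * y) (x * x) →
                   ∃[ x′ ] x′ < x × PrimitiveSolution x′
  descent-y-even {w} {x} {y} 0<w y≡w*2 record
    { m = m ; n = n ; m⊥n = m⊥n ; b≡2mn = y²≡2mn ; c≡m²+n² = x²≡m²+n² }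
    = [ (λ 2∣m → descent-square-area (coprime-sym m⊥n) 2∣m 0<w (trans (*-comm n m) mn≡2w²)
                    (trans (+-comm (n * n) (m * m)) (sym x²≡m²+n²)))
      , (λ 2∣n → descent-square-area m⊥n 2∣n 0<w mn≡2w² (sym x²≡m²+n²))
      ]′ (euclidsLemma m n (from-yes (prime? 2)) (subst (2 ∣_) (sym mn≡2w²) (m∣m*n (w * w))))
    where
    mn≡2w² : m * n ≡ 2 * (w * w)
    mn≡2w² = *-cancelˡ-≡ _ _ 2 (begin
      2 * (m * n)          ≡⟨ y²≡2mn ⟨
      y * y                ≡⟨ cong (λ k → k * k) y≡w*2 ⟩
      w * 2 * (w * 2)      ≡⟨ solve (w ∷ []) ⟩
      2 * (2 * (w * w))    ∎)

  smaller-solution : ∀ {x} → PrimitiveSolution x → ∃[ x′ ] x′ < x × PrimitiveSolution x′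
  smaller-solution {x} record { y = y ; z = z ; 0<y = 0<y ; 0<z = 0<z ; x⊥y = x⊥y ; x⁴≡y⁴+z² = x⁴≡y⁴+z² }
    with even⊎odd y | even⊎odd z
  ... | inj₁ (divides w y≡w*2) | _ =
    descent-y-even (0<m*n⇒0<m w (subst (0 <_) y≡w*2 0<y)) y≡w*2
      (primitive-triple-parameters (trans (+-comm (z * z) _) (sym x⁴≡y⁴+z²)) (coprime-sym y²⊥z)
                                   (∣m⇒∣m*n y (divides w y≡w*2)))
    where y²⊥z = coprime-leg {x} {y} {z} x⊥y x⁴≡y⁴+z²
  ... | inj₂ y-odd | inj₁ 2∣z =
    descent-y-odd 0<y 0<z (primitive-triple-parameters (sym x⁴≡y⁴+z²) (coprime-leg {x} {y} {z} x⊥y x⁴≡y⁴+z²) 2∣z)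
  ... | inj₂ y-odd | inj₂ z-odd =
    contradiction x⁴≡y⁴+z² (odd²+odd²≢square {x * x} {y * y} {z} (trans ([n*n]%2≡n%2 y) y-odd) z-odd)

  no-primitive-solution : ∀ x → ¬ PrimitiveSolution x
  no-primitive-solution = <-rec (λ x → ¬ PrimitiveSolution x) λ x descend solution →
    let x′ , x′<x , solution′ = smaller-solution solution in descend x′<x solution′

  [ag]⁴≡a⁴g⁴ : ∀ a g → a * g * (a * g) * (a * g * (a * g)) ≡ a * a * (a * a) * (g * g * (g * g))
  [ag]⁴≡a⁴g⁴ a g = solve (a ∷ g ∷ [])

  common-factor²∣ : ∀ x y g {z} → x * g * (x * g) * (x * g * (x * g)) ≡ y * g * (y * g) * (y * g * (y * g)) + z * z →
                    g * g ∣ z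
  common-factor²∣ x y g {z} eq = square-∣-square⇒∣ {g * g} {z} (∣m+n∣m⇒∣n
    (subst (g * g * (g * g) ∣_) (trans (sym ([ag]⁴≡a⁴g⁴ x g)) eq) (n∣m*n (x * x * (x * x))))
    (subst (g * g * (g * g) ∣_) (sym ([ag]⁴≡a⁴g⁴ y g)) (n∣m*n (y * y * (y * y)))))

  x⁴≢y⁴+z² : ∀ {x y z} → 0 < y → 0 < z → x * x * (x * x) ≢ y * y * (y * y) + z * z
  x⁴≢y⁴+z² {x} {y} {z} 0<y 0<z x⁴≡y⁴+z²
    with g , x′ , y′ , 0<g , refl , refl , x′⊥y′ ← gcd-cofactors x y 0<y
    with divides z′ refl ← common-factor²∣ x′ y′ g {z} x⁴≡y⁴+z²
    = no-primitive-solution x′ record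
    { y = y′ ; z = z′ ; 0<y = 0<m*n⇒0<m y′ 0<y ; 0<z = 0<m*n⇒0<m z′ 0<z ; x⊥y = x′⊥y′
    ; x⁴≡y⁴+z² = *-cancelʳ-≡ _ _ (g * g * (g * g)) (begin
        x′ * x′ * (x′ * x′) * (g * g * (g * g))               ≡⟨ [ag]⁴≡a⁴g⁴ x′ g ⟨
        x′ * g * (x′ * g) * (x′ * g * (x′ * g))               ≡⟨ x⁴≡y⁴+z² ⟩
        y′ * g * (y′ * g) * (y′ * g * (y′ * g)) + z′ * (g * g) * (z′ * (g * g))
                                                              ≡⟨ solve (y′ ∷ z′ ∷ g ∷ []) ⟩
        (y′ * y′ * (y′ * y′) + z′ * z′) * (g * g * (g * g))   ∎) }
    where instance _ = >-nonZero (*-mono-< (*-mono-< 0<g 0<g) (*-mono-< 0<g 0<g))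

module FermatDescentℤ where

  open import Data.Integer.Base
  open import Data.Integer.Properties using (pos-*; +-injective; ∣i∣≡0⇒i≡0)
  open import Data.Integer.Tactic.RingSolver using (solve-∀)
  import Data.Nat.Base as ℕ
  open import Data.Nat.Properties using (n≢0⇒n>0)
  open import Function using (_∘_)
  open import Relation.Binary.PropositionalEquality
  open ≡-Reasoning

  i*i≡+∣i∣*∣i∣ : ∀ i → i * i ≡ + (∣ i ∣ ℕ.* ∣ i ∣)
  i*i≡+∣i∣*∣i∣ (+ n)    = sym (pos-* n n)
  i*i≡+∣i∣*∣i∣ -[1+ n ] = refl

  i⁴≡+∣i∣⁴ : ∀ i → i * i * (i * i) ≡ + (∣ i ∣ ℕ.* ∣ i ∣ ℕ.* (∣ i ∣ ℕ.* ∣ i ∣))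
  i⁴≡+∣i∣⁴ i = trans (cong₂ _*_ (i*i≡+∣i∣*∣i∣ i) (i*i≡+∣i∣*∣i∣ i)) (sym (pos-* (∣ i ∣ ℕ.* ∣ i ∣) (∣ i ∣ ℕ.* ∣ i ∣)))

  x⁴≢y⁴+z² : ∀ x y z → y ≢ 0ℤ → z ≢ 0ℤ → x * x * (x * x) ≢ y * y * (y * y) + z * z
  x⁴≢y⁴+z² x y z y≢0 z≢0 x⁴≡y⁴+z² =
    FermatDescent.x⁴≢y⁴+z² {∣ x ∣} (∣∣-pos y≢0) (∣∣-pos z≢0) (+-injective (begin
      + (∣ x ∣ ℕ.* ∣ x ∣ ℕ.* (∣ x ∣ ℕ.* ∣ x ∣))                   ≡⟨ i⁴≡+∣i∣⁴ x ⟨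
      x * x * (x * x)                                           ≡⟨ x⁴≡y⁴+z² ⟩
      y * y * (y * y) + z * z                                   ≡⟨ cong₂ _+_ (i⁴≡+∣i∣⁴ y) (i*i≡+∣i∣*∣i∣ z) ⟩
      + (∣ y ∣ ℕ.* ∣ y ∣ ℕ.* (∣ y ∣ ℕ.* ∣ y ∣) ℕ.+ ∣ z ∣ ℕ.* ∣ z ∣) ∎))
    where
    ∣∣-pos : ∀ {i} → i ≢ 0ℤ → 0 ℕ.< ∣ i ∣
    ∣∣-pos i≢0 = n≢0⇒n>0 (i≢0 ∘ ∣i∣≡0⇒i≡0)

  -- The hypothesis is x⁴ = y² + 1 for x = n/d, y = u/e, cross-multiplied exactly as ℚᵘ
  -- arithmetic computes it (hence the factors 1ℤ).
  clear-denominators : ∀ n u d e →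
    n * n * (n * n) * (e * e * 1ℤ) ≡ (u * u * 1ℤ + 1ℤ * (e * e)) * (d * d * (d * d)) →
    let X = n * e ; Y = d * e ; Z = u * (d * d * e) in
    X * X * (X * X) ≡ Y * Y * (Y * Y) + Z * Z
  clear-denominators n u d e eq = begin
    (n * e) * (n * e) * ((n * e) * (n * e))                       ≡⟨ expand-lhs n e ⟩
    n * n * (n * n) * (e * e * 1ℤ) * (e * e)                      ≡⟨ cong (_* (e * e)) eq ⟩
    (u * u * 1ℤ + 1ℤ * (e * e)) * (d * d * (d * d)) * (e * e)     ≡⟨ expand-rhs u d e ⟩
    (d * e) * (d * e) * ((d * e) * (d * e)) + (u * (d * d * e)) * (u * (d * d * e)) ∎
    where
    expand-lhs : ∀ n e → (n * e) * (n * e) * ((n * e) * (n * e)) ≡ n * n * (n * n) * (e * e * 1ℤ) * (e * e)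
    expand-lhs = solve-∀
    expand-rhs : ∀ u d e → (u * u * 1ℤ + 1ℤ * (e * e)) * (d * d * (d * d)) * (e * e) ≡
                           (d * e) * (d * e) * ((d * e) * (d * e)) + (u * (d * d * e)) * (u * (d * d * e))
    expand-rhs = solve-∀

open import Defs
open import Data.Rational using (ℚ; mkℚ; 0ℚ; 1ℚ; _+_; _*_; _-_; -_; 1/_; toℚᵘ; NonNegative; ≢-nonZero)
import Data.Rational.Properties as ℚ
open import Data.Rational.Unnormalised as ℚᵘ using (*≡*)
import Data.Rational.Unnormalised.Properties as ℚᵘ
open import Data.Integer as ℤ using (+_; -[1+_]; 0ℤ)
import Data.Integer.Properties as ℤ
import Data.Nat as ℕ
open import Algebra.Properties.Group ℚ.+-0-group using (x∙y⁻¹≈ε⇒x≈y; x≈y⇒x∙y⁻¹≈ε; inverseˡ-unique)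
open import Tactic.RingSolver using (solve)
open import Tactic.RingSolver.Core.AlmostCommutativeRing using (AlmostCommutativeRing; fromCommutativeRing)
open import Data.List.Base using (_∷_; [])
open import Data.Product using (_×_; _,_)
open import Data.Sum using (_⊎_; inj₁; inj₂; [_,_])
open import Function using (_∘_)
open import Level using (0ℓ)
open import Relation.Nullary using (yes; no; contradiction)
open import Relation.Nullary.Decidable using (dec⇒maybe)
open import Relation.Binary.PropositionalEquality hiding ([_])
import Relation.Binary.Reasoning.Setoid as SetoidReasoning
open FermatDescentℤ using (x⁴≢y⁴+z²; clear-denominators)

private variable p q u x y : ℚ

toℚᵘ-pow4≃sq+1 : pow4 x ≡ sq y + 1ℚ →
                 toℚᵘ x ℚᵘ.* toℚᵘ x ℚᵘ.* (toℚᵘ x ℚᵘ.* toℚᵘ x) ℚᵘ.≃ toℚᵘ y ℚᵘ.* toℚᵘ y ℚᵘ.+ ℚᵘ.1ℚᵘ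
toℚᵘ-pow4≃sq+1 {x} {y} x⁴≡y²+1 = begin
  toℚᵘ x ℚᵘ.* toℚᵘ x ℚᵘ.* (toℚᵘ x ℚᵘ.* toℚᵘ x) ≈⟨ ℚᵘ.*-cong (ℚ.toℚᵘ-homo-* x x) (ℚ.toℚᵘ-homo-* x x) ⟨
  toℚᵘ (x * x) ℚᵘ.* toℚᵘ (x * x)                 ≈⟨ ℚ.toℚᵘ-homo-* (x * x) (x * x) ⟨
  toℚᵘ (pow4 x)                                   ≡⟨ cong toℚᵘ x⁴≡y²+1 ⟩
  toℚᵘ (sq y + 1ℚ)                                ≈⟨ ℚ.toℚᵘ-homo-+ (sq y) 1ℚ ⟩
  toℚᵘ (y * y) ℚᵘ.+ ℚᵘ.1ℚᵘ                        ≈⟨ ℚᵘ.+-congˡ ℚᵘ.1ℚᵘ (ℚ.toℚᵘ-homo-* y y) ⟩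
  toℚᵘ y ℚᵘ.* toℚᵘ y ℚᵘ.+ ℚᵘ.1ℚᵘ                  ∎
  where open SetoidReasoning ℚᵘ.≃-setoid

pow4≢sq+1 : ∀ x y → y ≢ 0ℚ → pow4 x ≢ sq y + 1ℚ
pow4≢sq+1 x@(mkℚ n d _) y@(mkℚ u e _) y≢0 x⁴≡y²+1 with toℚᵘ-pow4≃sq+1 {x} {y} x⁴≡y²+1
... | *≡* cross = x⁴≢y⁴+z² (n ℤ.* E) (D ℤ.* E) (u ℤ.* (D ℤ.* D ℤ.* E)) (λ ()) u*D²E≢0
                    (clear-denominators n u D E cross)
  where
  D = + ℕ.suc d
  E = + ℕ.suc e
  u*D²E≢0 : u ℤ.* (D ℤ.* D ℤ.* E) ≢ 0ℤ
  u*D²E≢0 uD²E≡0 = [ y≢0 ∘ ℚ.↥p≡0⇒p≡0 y , (λ ()) ] (ℤ.i*j≡0⇒i≡0∨j≡0 u uD²E≡0)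

ℚ-ring : AlmostCommutativeRing 0ℓ 0ℓ
ℚ-ring = fromCommutativeRing ℚ.+-*-commutativeRing (dec⇒maybe ∘ (0ℚ ℚ.≟_))

x*y≡0⇒x≡0∨y≡0 : x * y ≡ 0ℚ → x ≡ 0ℚ ⊎ y ≡ 0ℚ
x*y≡0⇒x≡0∨y≡0 {x} {y} xy≡0 with x ℚ.≟ 0ℚ
... | yes x≡0 = inj₁ x≡0
... | no x≢0 = inj₂ (begin
  y                ≡⟨ ℚ.*-identityˡ y ⟨
  1ℚ * y           ≡⟨ cong (_* y) (ℚ.*-inverseˡ x) ⟨
  1/ x * x * y     ≡⟨ ℚ.*-assoc (1/ x) x y ⟩
  1/ x * (x * y)   ≡⟨ cong (1/ x *_) xy≡0 ⟩
  1/ x * 0ℚ        ≡⟨ ℚ.*-zeroʳ (1/ x) ⟩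
  0ℚ               ∎)
  where
  open ≡-Reasoning
  instance _ = ≢-nonZero x≢0

sq-nonNeg : ∀ x → NonNegative (sq x)
sq-nonNeg x@(mkℚ (+ _) _ _)    = ℚ.nonNeg*nonNeg⇒nonNeg x x
sq-nonNeg x@(mkℚ -[1+ _ ] _ _) = ℚ.pos⇒nonNeg (x * x) {{ℚ.neg*neg⇒pos x x}}

sq≡sq⇒≡∨≡- : sq x ≡ sq y → x ≡ y ⊎ x ≡ - y
sq≡sq⇒≡∨≡- {x} {y} x²≡y² with x*y≡0⇒x≡0∨y≡0 (begin
  (x - y) * (x + y)  ≡⟨ solve (x ∷ y ∷ []) ℚ-ring ⟩
  x * x - y * y      ≡⟨ x≈y⇒x∙y⁻¹≈ε x²≡y² ⟩
  0ℚ                 ∎)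
  where open ≡-Reasoning
... | inj₁ x-y≡0 = inj₁ (x∙y⁻¹≈ε⇒x≈y x y x-y≡0)
... | inj₂ x+y≡0 = inj₂ (inverseˡ-unique x y x+y≡0)

sq≢-1 : ∀ x → sq x ≢ - 1ℚ
sq≢-1 x = ℚ.nonNeg≢neg (sq x) (- 1ℚ) {{sq-nonNeg x}}

1≡sq1 : 1ℚ ≡ sq 1ℚ
1≡sq1 = sym (ℚ.*-identityʳ 1ℚ)

pow4≡1⇒≡1∨≡-1 : pow4 x ≡ 1ℚ → x ≡ 1ℚ ⊎ x ≡ - 1ℚ
pow4≡1⇒≡1∨≡-1 {x} x⁴≡1 =
  [ (λ x²≡1 → sq≡sq⇒≡∨≡- {x} {1ℚ} (trans x²≡1 1≡sq1)) , (λ x²≡-1 → contradiction x²≡-1 (sq≢-1 x)) ]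
  (sq≡sq⇒≡∨≡- {sq x} {1ℚ} (trans x⁴≡1 1≡sq1))

p/ℚq*q≡p : q ≢ 0ℚ → p /ℚ q * q ≡ p
p/ℚq*q≡p {q} {p} q≢0 with q ℚ.≟ 0ℚ
... | yes q≡0 = contradiction q≡0 q≢0
... | no q≢0 = begin
  p * 1/ q * q    ≡⟨ ℚ.*-assoc p (1/ q) q ⟩
  p * (1/ q * q)  ≡⟨ cong (p *_) (ℚ.*-inverseˡ q) ⟩
  p * 1ℚ          ≡⟨ ℚ.*-identityʳ p ⟩
  p               ∎
  where
  open ≡-Reasoning
  instance _ = ≢-nonZero q≢0

p*q/ℚq≡p : q ≢ 0ℚ → p * q /ℚ q ≡ p
p*q/ℚq≡p {q} {p} q≢0 with q ℚ.≟ 0ℚ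
... | yes q≡0 = contradiction q≡0 q≢0
... | no q≢0 = begin
  p * q * 1/ q    ≡⟨ ℚ.*-assoc p q (1/ q) ⟩
  p * (q * 1/ q)  ≡⟨ cong (p *_) (ℚ.*-inverseʳ q) ⟩
  p * 1ℚ          ≡⟨ ℚ.*-identityʳ p ⟩
  p               ∎
  where
  open ≡-Reasoning
  instance _ = ≢-nonZero q≢0

q*[[p-1]/ℚq]+1≡p : q ≢ 0ℚ → q * ((p - 1ℚ) /ℚ q) + 1ℚ ≡ p
q*[[p-1]/ℚq]+1≡p {q} {p} q≢0 = begin
  q * ((p - 1ℚ) /ℚ q) + 1ℚ  ≡⟨ cong (_+ 1ℚ) (trans (ℚ.*-comm q _) (p/ℚq*q≡p q≢0)) ⟩
  p - 1ℚ + 1ℚ               ≡⟨ solve (p ∷ []) ℚ-ring ⟩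
  p                         ∎
  where open ≡-Reasoning

-- R, S, T stand for r², s², t², and hyp is the hypothesis of the theorem multiplied out by a = S − R.
module ClearedHypothesis (R S T : ℚ) (hyp : S * R - 1ℚ ≡ T * (S - R)) where
  open ≡-Reasoning

  R²-1≡[T-R][S-R] : R * R - 1ℚ ≡ (T - R) * (S - R)
  R²-1≡[T-R][S-R] = begin
    R * R - 1ℚ                  ≡⟨ solve (R ∷ S ∷ []) ℚ-ring ⟩
    (S * R - 1ℚ) - R * (S - R)  ≡⟨ cong (_- R * (S - R)) hyp ⟩
    T * (S - R) - R * (S - R)   ≡⟨ solve (R ∷ S ∷ T ∷ []) ℚ-ring ⟩
    (T - R) * (S - R)           ∎

  S²-1≡[S+T][S-R] : S * S - 1ℚ ≡ (S + T) * (S - R)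
  S²-1≡[S+T][S-R] = begin
    S * S - 1ℚ                  ≡⟨ solve (R ∷ S ∷ []) ℚ-ring ⟩
    (S * R - 1ℚ) + S * (S - R)  ≡⟨ cong (_+ S * (S - R)) hyp ⟩
    T * (S - R) + S * (S - R)   ≡⟨ solve (R ∷ S ∷ T ∷ []) ℚ-ring ⟩
    (S + T) * (S - R)           ∎

  [T-R][S+T]+1≡T² : (T - R) * (S + T) + 1ℚ ≡ T * T
  [T-R][S+T]+1≡T² = begin
    (T - R) * (S + T) + 1ℚ                     ≡⟨ solve (R ∷ S ∷ T ∷ []) ℚ-ring ⟩
    T * T + T * (S - R) - (S * R - 1ℚ)         ≡⟨ cong (λ h → T * T + T * (S - R) - h) hyp ⟩
    T * T + T * (S - R) - T * (S - R)          ≡⟨ solve (R ∷ S ∷ T ∷ []) ℚ-ring ⟩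
    T * T                                      ∎

*+1≡pow4⇒≢ : x ≢ 0ℚ → x * y + 1ℚ ≡ pow4 u → x ≢ y
*+1≡pow4⇒≢ {x} {u = u} x≢0 xx+1≡u⁴ refl = pow4≢sq+1 u x x≢0 (sym xx+1≡u⁴)

*+1≡pow4⇒≢0 : u ≢ 1ℚ → u ≢ - 1ℚ → x * y + 1ℚ ≡ pow4 u → y ≢ 0ℚ
*+1≡pow4⇒≢0 {u} {x} u≢1 u≢-1 x0+1≡u⁴ refl = [ u≢1 , u≢-1 ] (pow4≡1⇒≡1∨≡-1 (begin
  pow4 u         ≡⟨ x0+1≡u⁴ ⟨
  x * 0ℚ + 1ℚ    ≡⟨ cong (_+ 1ℚ) (ℚ.*-zeroʳ x) ⟩
  0ℚ + 1ℚ        ≡⟨ ℚ.+-identityˡ 1ℚ ⟩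
  1ℚ             ∎))
  where open ≡-Reasoning

quartic-triple : ∀ {a b c r s t} → a ≢ 0ℚ → b ≢ 0ℚ → c ≢ 0ℚ →
                 a * b + 1ℚ ≡ pow4 r → a * c + 1ℚ ≡ pow4 s → b * c + 1ℚ ≡ pow4 t →
                 QuarticDiophantineTriple a b c
quartic-triple {r = r} {s} {t} a≢0 b≢0 c≢0 ab+1≡r⁴ ac+1≡s⁴ bc+1≡t⁴ =
  (*+1≡pow4⇒≢ {u = r} a≢0 ab+1≡r⁴ , *+1≡pow4⇒≢ {u = s} a≢0 ac+1≡s⁴ , *+1≡pow4⇒≢ {u = t} b≢0 bc+1≡t⁴) ,
  (a≢0 , b≢0 , c≢0) , (r , ab+1≡r⁴) , (s , ac+1≡s⁴) , (t , bc+1≡t⁴)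

mainTheorem2 : (r s t : ℚ) →
    r ≢ 1ℚ → r ≢ - 1ℚ → s ≢ 1ℚ → s ≢ - 1ℚ → s ≢ r → s ≢ - r →
    (sq s * sq r - 1ℚ) /ℚ (sq s - sq r) ≡ sq t →
    let a = sq s - sq r
        b = (pow4 r - 1ℚ) /ℚ a
        c = (pow4 s - 1ℚ) /ℚ a
    in (b ≡ sq t - sq r) × (c ≡ sq s + sq t) × QuarticDiophantineTriple a b c
mainTheorem2 r s t r≢1 r≢-1 s≢1 s≢-1 s≢r s≢-r hyp =
  b≡t²-r² , c≡s²+t² , quartic-triple {r = r} {s} {t} a≢0 b≢0 c≢0 ab+1≡r⁴ ac+1≡s⁴ bc+1≡t⁴
  where
  a = sq s - sq r
  b = (pow4 r - 1ℚ) /ℚ a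
  c = (pow4 s - 1ℚ) /ℚ a
  a≢0 : a ≢ 0ℚ
  a≢0 a≡0 = [ s≢r , s≢-r ] (sq≡sq⇒≡∨≡- {s} {r} (x∙y⁻¹≈ε⇒x≈y (sq s) (sq r) a≡0))
  open ClearedHypothesis (sq r) (sq s) (sq t) (trans (sym (p/ℚq*q≡p a≢0)) (cong (_* a) hyp))
  b≡t²-r² : b ≡ sq t - sq r
  b≡t²-r² = trans (cong (_/ℚ a) R²-1≡[T-R][S-R]) (p*q/ℚq≡p a≢0)
  c≡s²+t² : c ≡ sq s + sq t
  c≡s²+t² = trans (cong (_/ℚ a) S²-1≡[S+T][S-R]) (p*q/ℚq≡p a≢0)
  ab+1≡r⁴ : a * b + 1ℚ ≡ pow4 r
  ab+1≡r⁴ = q*[[p-1]/ℚq]+1≡p a≢0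
  ac+1≡s⁴ : a * c + 1ℚ ≡ pow4 s
  ac+1≡s⁴ = q*[[p-1]/ℚq]+1≡p a≢0
  bc+1≡t⁴ : b * c + 1ℚ ≡ pow4 t
  bc+1≡t⁴ = trans (cong₂ (λ b c → b * c + 1ℚ) b≡t²-r² c≡s²+t²) [T-R][S+T]+1≡T²
  b≢0 : b ≢ 0ℚ
  b≢0 = *+1≡pow4⇒≢0 {r} {a} r≢1 r≢-1 ab+1≡r⁴
  c≢0 : c ≢ 0ℚ
  c≢0 = *+1≡pow4⇒≢0 {s} {a} s≢1 s≢-1 ac+1≡s⁴
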